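{- $R(W_5, W_7) \ge 15$.
   Context: For graphs $G_1,G_2$, the Ramsey number $R(G_1,G_2)$ is the smallest positive integer $N$ such that every red-blue edge-coloring of $K_N$ contains a red copy of $G_1$ or a blue copy of $G_2$. The wheel $W_n$ is the graph on $n$ vertices obtained by adding a new vertex adjacent to every vertex of the cycle $C_{n-1}$. -}

module Defs where

open import Data.Nat using (ℕ; zero; suc; _<_; NonZero)
open import Data.Nat.DivMod using (_%_)
open import Data.Fin using (Fin; zero; suc; toℕ)
open import Data.Bool using (Bool; true; false)
open import Data.Unit using (⊤)
open import Data.Empty using (⊥)
open import Data.Sum using (_⊎_)
open import Data.Product using (Σ; _×_)
open import Relation.Binary.PropositionalEquality using (_≡_)
open import Function.Definitions using (Injective)
open import Relation.Nullary using (¬_)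

record Graph (n : ℕ) : Set₁ where
  field
    Adj : Fin n → Fin n → Set

open Graph public

CycleAdj : (m : ℕ) → .{{_ : NonZero m}} → Fin m → Fin m → Set
CycleAdj m i j = (toℕ j ≡ suc (toℕ i) % m) ⊎ (toℕ i ≡ suc (toℕ j) % m)

-- Wheel W_n (n vertices): vertex 0 is the hub, adjacent to every vertex of the
-- cycle C_{n-1} formed by the remaining vertices suc i.
WheelAdj : (m : ℕ) → .{{_ : NonZero m}} → Fin (suc m) → Fin (suc m) → Set
WheelAdj m zero    zero    = ⊥
WheelAdj m zero    (suc j) = ⊤
WheelAdj m (suc i) zero    = ⊤
WheelAdj m (suc i) (suc j) = CycleAdj m i j

Wheel : (m : ℕ) → .{{_ : NonZero m}} → Graph (suc m)
Wheel m = record { Adj = WheelAdj m }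

W5 : Graph 5
W5 = Wheel 4

W7 : Graph 7
W7 = Wheel 6

red blue : Bool
red  = true
blue = false

-- A red-blue colouring of the edges of K_N: a symmetric colour function
-- (values on the diagonal are irrelevant).
record Colouring (N : ℕ) : Set where
  field
    col : Fin N → Fin N → Bool
    sym : ∀ i j → col i j ≡ col j i

open Colouring public

HasCopy : {k N : ℕ} → Graph k → Colouring N → Bool → Set
HasCopy {k} {N} G c b =
  Σ (Fin k → Fin N) λ f → Injective _≡_ _≡_ f × (∀ i j → Adj G i j → col c (f i) (f j) ≡ b)

Arrows : {k l : ℕ} → ℕ → Graph k → Graph l → Set
Arrows N G₁ G₂ = (c : Colouring N) → HasCopy G₁ c red ⊎ HasCopy G₂ c blue

-- R(G₁,G₂) ≥ r : no N < r has the arrow property (R is the least N that does).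
RamseyGE : {k l : ℕ} → Graph k → Graph l → ℕ → Set
RamseyGE G₁ G₂ r = ∀ N → N < r → ¬ Arrows N G₁ G₂

-- A red/blue colouring of K₁₄ with no red W₅ and no blue W₇ shows R(W₅, W₇) > 14.
-- A copy of the wheel W_{m+1} in colour b is a vertex together with a b-coloured
-- m-cycle through its b-neighbours, so such copies can be excluded by a depth-first
-- search over paths of distinct neighbours of each vertex.
module Submission where

open import Defs hiding (sym)
open import Data.Nat using (ℕ; zero; suc; _+_; _<_; _≤_; z≤n; s≤s; s≤s⁻¹; NonZero)
open import Data.Nat.Properties
  using (≤-refl; m≤n⇒m≤1+n; m≤n+m; +-suc; +-identityʳ; <-trans; <⇒≢)
open import Data.Nat.DivMod
  using (_%_; _mod_; %-distribˡ-+; m%n%n≡m%n; m%n<n; [m+n]%n≡m%n; m<n⇒m%n≡m)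
open import Data.Fin using (Fin; zero; suc; toℕ; inject≤; _≟_)
open import Data.Fin.Properties
  using (any?; all?; 0≢1+n; toℕ-fromℕ<; toℕ-injective; inject≤-injective; suc-injective)
open import Data.Vec using (Vec; _∷_; []; lookup)
open import Data.Bool using (Bool; true; false)
import Data.Bool.Properties as Bool
open import Data.List using (List; _∷_; [])
open import Data.List.Membership.Propositional using (_∈_; _∉_)
open import Data.List.Relation.Unary.Any using (here; there)
open import Data.Unit using (tt)
open import Data.Sum using (_⊎_; inj₁; inj₂; [_,_]′)
open import Data.Product using (∃; _×_; _,_; proj₂)
open import Function using (_∘_)
open import Function.Definitions using (Injective)
open import Relation.Nullary using (¬_; Dec; ¬?)
open import Relation.Nullary.Decidable using (_×-dec_; toWitness; toWitnessFalse)
open import Level using (0ℓ)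
open import Relation.Binary using (Rel; Decidable)
open import Relation.Binary.PropositionalEquality
  using (_≡_; _≢_; refl; sym; trans; cong; subst; module ≡-Reasoning)

private
  variable
    k l m N : ℕ

restrict : {M : ℕ} → Colouring N → (Fin M → Fin N) → Colouring M
restrict c ι = record { col = λ i j → col c (ι i) (ι j) ; sym = λ i j → Colouring.sym c (ι i) (ι j) }

copy-restrict : {M : ℕ} {G : Graph k} (c : Colouring N) {ι : Fin M → Fin N} {b : Bool} →
                Injective _≡_ _≡_ ι → HasCopy G (restrict c ι) b → HasCopy G c b
copy-restrict c ι-inj (f , f-inj , edges) = (_ , f-inj ∘ ι-inj , edges)

Good : Graph k → Graph l → Colouring N → Set
Good G₁ G₂ c = ¬ HasCopy G₁ c red × ¬ HasCopy G₂ c blue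

good⇒RamseyGE : {G₁ : Graph k} {G₂ : Graph l} (c : Colouring N) →
                Good G₁ G₂ c → RamseyGE G₁ G₂ (suc N)
good⇒RamseyGE c (noRed , noBlue) M M<1+N arrows =
  [ noRed ∘ copy-restrict c ι-injective , noBlue ∘ copy-restrict c ι-injective ]′ (arrows (restrict c ι))
  where
    ι : Fin M → Fin _
    ι i = inject≤ i (s≤s⁻¹ M<1+N)
    ι-injective : Injective _≡_ _≡_ ι
    ι-injective = inject≤-injective _ _ _ _

Coloured : Colouring N → Bool → Rel (Fin N) 0ℓ
Coloured c b x y = col c x y ≡ b

-- An m-cycle vertex 0, …, vertex (m − 1) in the neighbourhood of hub; indexing by
-- all of ℕ lets the closing edge be the instance rim (m − 1) together with closed.
record Rim {N : ℕ} (_~_ : Rel (Fin N) 0ℓ) (hub : Fin N) (m : ℕ) : Set where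
  field
    vertex   : ℕ → Fin N
    spoke    : ∀ i → hub ~ vertex i
    rim      : ∀ i → vertex i ~ vertex (suc i)
    closed   : vertex m ≡ vertex 0
    off-hub  : ∀ i → vertex i ≢ hub
    distinct : ∀ {i j} → i < j → j < m → vertex i ≢ vertex j

[1+m]%n≡[1+m%n]%n : ∀ m n .{{_ : NonZero n}} → suc m % n ≡ suc (m % n) % n
[1+m]%n≡[1+m%n]%n m n = begin
  (1 + m) % n               ≡⟨ %-distribˡ-+ 1 m n ⟩
  (1 % n + m % n) % n       ≡⟨ cong (λ x → (1 % n + x) % n) (m%n%n≡m%n m n) ⟨
  (1 % n + m % n % n) % n   ≡⟨ %-distribˡ-+ 1 (m % n) n ⟨
  (1 + m % n) % n           ∎
  where open ≡-Reasoning

toℕ-mod : ∀ m n .{{_ : NonZero n}} → toℕ (m mod n) ≡ m % n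
toℕ-mod m n = toℕ-fromℕ< (m%n<n m n)

wheel-copy⇒Rim : {c : Colouring N} {b : Bool} .{{_ : NonZero m}} →
                 HasCopy (Wheel m) c b → ∃ λ hub → Rim (Coloured c b) hub m
wheel-copy⇒Rim {m = m} (f , f-inj , edges) = f zero , record
  { vertex   = vertex
  ; spoke    = λ i → edges zero (suc (i mod m)) tt
  ; rim      = λ i → edges (suc (i mod m)) (suc (suc i mod m)) (inj₁ (successor i))
  ; closed   = cong (f ∘ suc) (toℕ-injective periodic)
  ; off-hub  = λ i e → 0≢1+n (sym (f-inj e))
  ; distinct = λ i<j j<m e → <⇒≢ i<j (mod-injective (<-trans i<j j<m) j<m (suc-injective (f-inj e)))
  }
  where
    vertex : ℕ → Fin _
    vertex i = f (suc (i mod m))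
    periodic : toℕ (m mod m) ≡ toℕ (0 mod m)
    periodic = trans (toℕ-mod m m) (trans ([m+n]%n≡m%n 0 m) (sym (toℕ-mod 0 m)))
    successor : ∀ i → toℕ (suc i mod m) ≡ suc (toℕ (i mod m)) % m
    successor i = begin
      toℕ (suc i mod m)       ≡⟨ toℕ-mod (suc i) m ⟩
      suc i % m               ≡⟨ [1+m]%n≡[1+m%n]%n i m ⟩
      suc (i % m) % m         ≡⟨ cong (λ x → suc x % m) (toℕ-mod i m) ⟨
      suc (toℕ (i mod m)) % m ∎
      where open ≡-Reasoning
    mod-injective : ∀ {i j} → i < m → j < m → i mod m ≡ j mod m → i ≡ j
    mod-injective {i} {j} i<m j<m e = begin
      i                 ≡⟨ m<n⇒m%n≡m i<m ⟨
      i % m             ≡⟨ toℕ-mod i m ⟨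
      toℕ (i mod m)     ≡⟨ cong toℕ e ⟩
      toℕ (j mod m)     ≡⟨ toℕ-mod j m ⟩
      j % m             ≡⟨ m<n⇒m%n≡m j<m ⟩
      j                 ∎
      where open ≡-Reasoning

module RimSearch {N : ℕ} {_~_ : Rel (Fin N) 0ℓ} (_~?_ : Decidable _~_) where
  open import Data.List.Membership.DecPropositional (_≟_ {N}) using (_∉?_)

  Closable : (hub first : Fin N) → ℕ → (last : Fin N) → (visited : List (Fin N)) → Set
  Closable hub first zero    x vs = x ~ first
  Closable hub first (suc k) x vs =
    ∃ λ y → hub ~ y × x ~ y × y ∉ vs × Closable hub first k y (y ∷ vs)

  closable? : ∀ hub first k x vs → Dec (Closable hub first k x vs)
  closable? hub first zero    x vs = x ~? first
  closable? hub first (suc k) x vs = any? λ y →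
    hub ~? y ×-dec x ~? y ×-dec y ∉? vs ×-dec closable? hub first k y (y ∷ vs)

  HasRim : ℕ → Set
  HasRim k = ∃ λ hub → ∃ λ first →
    hub ~ first × first ≢ hub × Closable hub first k first (first ∷ hub ∷ [])

  hasRim? : ∀ k → Dec (HasRim k)
  hasRim? k = any? λ hub → any? λ first →
    hub ~? first ×-dec ¬? (first ≟ hub) ×-dec closable? hub first k first (first ∷ hub ∷ [])

  Rim⇒HasRim : ∀ {hub k} → Rim _~_ hub (suc k) → HasRim k
  Rim⇒HasRim {hub} {k} R =
    hub , vertex 0 , spoke 0 , off-hub 0 , closes k 0 (+-identityʳ k) _ start
    where
      open Rim R
      Visited : ℕ → List (Fin N) → Set
      Visited j vs = ∀ {v} → v ∈ vs → v ≡ hub ⊎ ∃ λ i → i ≤ j × v ≡ vertex i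

      start : Visited 0 (vertex 0 ∷ hub ∷ [])
      start (here e)         = inj₂ (0 , z≤n , e)
      start (there (here e)) = inj₁ e

      closes : ∀ r j → r + j ≡ k → ∀ vs → Visited j vs → Closable hub (vertex 0) r (vertex j) vs
      closes zero    j refl vs _  = subst (vertex j ~_) closed (rim j)
      closes (suc r) j r+j≡k vs seen =
        vertex (suc j) , spoke (suc j) , rim j , fresh ,
        closes r (suc j) (trans (+-suc r j) r+j≡k) _ seen′
        where
          1+j<1+k : suc j < suc k
          1+j<1+k = s≤s (subst (suc j ≤_) r+j≡k (s≤s (m≤n+m j r)))

          fresh : vertex (suc j) ∉ vs
          fresh v∈vs with seen v∈vs
          ... | inj₁ e           = off-hub (suc j) e
          ... | inj₂ (i , i≤j , e) = distinct (s≤s i≤j) 1+j<1+k (sym e)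

          seen′ : Visited (suc j) (vertex (suc j) ∷ vs)
          seen′ (here e)   = inj₂ (suc j , ≤-refl , e)
          seen′ (there v∈vs) with seen v∈vs
          ... | inj₁ e           = inj₁ e
          ... | inj₂ (i , i≤j , e) = inj₂ (i , m≤n⇒m≤1+n i≤j , e)

open RimSearch using (HasRim; hasRim?; Rim⇒HasRim)

coloured? : (c : Colouring N) (b : Bool) → Decidable (Coloured c b)
coloured? c b x y = col c x y Bool.≟ b

¬HasRim⇒¬wheel-copy : (c : Colouring N) (b : Bool) →
                      ¬ HasRim (coloured? c b) k → ¬ HasCopy (Wheel (suc k)) c b
¬HasRim⇒¬wheel-copy c b noRim =
  noRim ∘ Rim⇒HasRim (coloured? c b) ∘ proj₂ ∘ wheel-copy⇒Rim {c = c} {b}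

colour-table : Vec (Vec Bool 14) 14
colour-table =
  (false ∷ false ∷ false ∷ true ∷ true ∷ false ∷ true ∷ true ∷ true ∷ true ∷ false ∷ false ∷ true ∷ false ∷ [])
  ∷ (false ∷ false ∷ true ∷ false ∷ true ∷ false ∷ false ∷ true ∷ true ∷ false ∷ true ∷ true ∷ false ∷ true ∷ [])
  ∷ (false ∷ true ∷ false ∷ true ∷ true ∷ false ∷ true ∷ false ∷ false ∷ false ∷ true ∷ false ∷ true ∷ false ∷ [])
  ∷ (true ∷ false ∷ true ∷ false ∷ false ∷ true ∷ true ∷ true ∷ false ∷ false ∷ true ∷ false ∷ false ∷ false ∷ [])
  ∷ (true ∷ true ∷ true ∷ false ∷ false ∷ true ∷ false ∷ true ∷ false ∷ false ∷ true ∷ false ∷ false ∷ false ∷ [])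
  ∷ (false ∷ false ∷ false ∷ true ∷ true ∷ false ∷ true ∷ false ∷ false ∷ true ∷ false ∷ true ∷ true ∷ true ∷ [])
  ∷ (true ∷ false ∷ true ∷ true ∷ false ∷ true ∷ false ∷ false ∷ true ∷ false ∷ true ∷ true ∷ false ∷ false ∷ [])
  ∷ (true ∷ true ∷ false ∷ true ∷ true ∷ false ∷ false ∷ false ∷ false ∷ true ∷ false ∷ false ∷ false ∷ true ∷ [])
  ∷ (true ∷ true ∷ false ∷ false ∷ false ∷ false ∷ true ∷ false ∷ false ∷ true ∷ false ∷ false ∷ true ∷ true ∷ [])
  ∷ (true ∷ false ∷ false ∷ false ∷ false ∷ true ∷ false ∷ true ∷ true ∷ false ∷ false ∷ true ∷ true ∷ false ∷ [])
  ∷ (false ∷ true ∷ true ∷ true ∷ true ∷ false ∷ true ∷ false ∷ false ∷ false ∷ false ∷ false ∷ true ∷ false ∷ [])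
  ∷ (false ∷ true ∷ false ∷ false ∷ false ∷ true ∷ true ∷ false ∷ false ∷ true ∷ false ∷ false ∷ true ∷ true ∷ [])
  ∷ (true ∷ false ∷ true ∷ false ∷ false ∷ true ∷ false ∷ false ∷ true ∷ true ∷ true ∷ true ∷ false ∷ false ∷ [])
  ∷ (false ∷ true ∷ false ∷ false ∷ false ∷ true ∷ false ∷ true ∷ true ∷ false ∷ false ∷ true ∷ false ∷ false ∷ [])
  ∷ []

colouring₁₄ : Colouring 14
colouring₁₄ = record
  { col = colour
  ; sym = toWitness {a? = all? λ i → all? λ j → colour i j Bool.≟ colour j i} tt
  }
  where
    colour : Fin 14 → Fin 14 → Bool
    colour i j = lookup (lookup colour-table i) j

colouring₁₄-good : Good W5 W7 colouring₁₄
colouring₁₄-good =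
    ¬HasRim⇒¬wheel-copy colouring₁₄ red  (toWitnessFalse {a? = hasRim? (coloured? colouring₁₄ red) 3} tt)
  , ¬HasRim⇒¬wheel-copy colouring₁₄ blue (toWitnessFalse {a? = hasRim? (coloured? colouring₁₄ blue) 5} tt)

theorem6 : RamseyGE W5 W7 15
theorem6 = good⇒RamseyGE colouring₁₄ colouring₁₄-good
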